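{- For all $\psi,\phi\in\mathfrak{stab}_{\mathfrak{Lie}(X)}(\Delta_Y)$ we have $\{\psi,\phi\}\in\mathfrak{ls}$; that is, $\{\mathfrak{stab}_{\mathfrak{Lie}(X)}(\Delta_Y),\mathfrak{stab}_{\mathfrak{Lie}(X)}(\Delta_Y)\}\subset\mathfrak{ls}$.
   Context: $\mathbb{Q}\langle X\rangle$ is the free associative $\mathbb{Q}$-algebra on $X=\{x_0,x_1\}$ with coproduct $\Delta_X$ the algebra morphism with $\Delta_X(x_i)=x_i\otimes1+1\otimes x_i$; $\mathfrak{Lie}(X)$ is the free Lie algebra on $X$ (= $\Delta_X$-primitives). $\mathbb{Q}\langle Y\rangle$ is the free associative algebra on $Y=\{y_1,y_2,\dots\}$ with coproduct $\Delta_Y(y_n)=y_n\otimes1+1\otimes y_n$ (algebra morphism). Identify $\mathbb{Q}\langle Y\rangle\subset\mathbb{Q}\langle X\rangle$ via $y_n\mapsto x_0^{n-1}x_1$; $\pi_Y:\mathbb{Q}\langle X\rangle\to\mathbb{Q}\langle Y\rangle$ sends $x_0^{k_1-1}x_1\cdots x_0^{k_d-1}x_1x_0^r$ to $y_{k_1}\cdots y_{k_d}$ if $r=0$ and to $0$ otherwise. $(\psi\mid w)$ is the coefficient of the word $w$ in $\psi$. For $\psi\in\mathbb{Q}\langle X\rangle$, $d_\psi$ is the derivation with $d_\psi(x_0)=0$, $d_\psi(x_1)=[x_1,\psi]$; the Ihara bracket $\{\psi_1,\psi_2\}=d_{\psi_1}(\psi_2)-d_{\psi_2}(\psi_1)+[\psi_1,\psi_2]$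 is a Lie bracket on $\mathfrak{Lie}(X)$. For $\psi\in\mathfrak{Lie}(X)$, $s_\psi=\ell_\psi+d_\psi$ ($\ell_\psi$ left multiplication) preserves $\mathbb{Q}\langle X\rangle x_0$ and induces the unique linear $s^Y_\psi$ on $\mathbb{Q}\langle Y\rangle$ with $\pi_Y\circ s_\psi=s^Y_\psi\circ\pi_Y$. $\mathfrak{stab}_{\mathfrak{Lie}(X)}(\Delta_Y)=\{\psi\in\mathfrak{Lie}(X)\mid(s^Y_\psi\otimes\mathrm{id}+\mathrm{id}\otimes s^Y_\psi)\circ\Delta_Y=\Delta_Y\circ s^Y_\psi\}$. $\mathfrak{ls}$ is the set of $\psi\in\mathbb{Q}\langle X\rangle$ with (i) $(\psi\mid x_0)=(\psi\mid x_1)=0$; (ii) $\psi$ is $\Delta_X$-primitive; (iii) $\pi_Y(\psi)$ is $\Delta_Y$-primitive; (iv) $(\psi\mid x_0^{n-1}x_1)=0$ for all even $n\ge2$. -}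

module Defs where

open import Data.Nat as ℕ using (ℕ; zero; suc)
open import Data.Rational using (ℚ; 0ℚ; 1ℚ; _+_; _*_; -_)
open import Data.List using (List; []; _∷_; _++_; [_]; replicate; concatMap; map)
import Data.List.Properties as LP
open import Data.Maybe using (Maybe; just; nothing)
open import Data.Product using (_×_; _,_)
open import Relation.Binary.PropositionalEquality using (_≡_; refl)
open import Relation.Binary.Definitions using (DecidableEquality)
open import Relation.Nullary using (yes; no)

-- Equality of polynomials is coefficient-wise equality (_≈_).

module Poly {A : Set} (_≟A_ : DecidableEquality A) where

  Word : Set
  Word = List A

  _≟W_ : DecidableEquality Word
  _≟W_ = LP.≡-dec _≟A_

  Pol : Set
  Pol = List (ℚ × Word)

  -- element of ℚ⟨A⟩ ⊗ ℚ⟨A⟩ (basis: pairs of words)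
  Pol2 : Set
  Pol2 = List (ℚ × Word × Word)

  coeff : Pol → Word → ℚ
  coeff [] w = 0ℚ
  coeff ((c , u) ∷ p) w with u ≟W w
  ... | yes _ = c + coeff p w
  ... | no  _ = coeff p w

  coeff2 : Pol2 → Word → Word → ℚ
  coeff2 [] u v = 0ℚ
  coeff2 ((c , a , b) ∷ p) u v with a ≟W u | b ≟W v
  ... | yes _ | yes _ = c + coeff2 p u v
  ... | _     | _     = coeff2 p u v

  _≈_ : Pol → Pol → Set
  p ≈ q = ∀ w → coeff p w ≡ coeff q w

  _≈₂_ : Pol2 → Pol2 → Set
  p ≈₂ q = ∀ u v → coeff2 p u v ≡ coeff2 q u v

  zeroP : Pol
  zeroP = []

  oneP : Pol
  oneP = (1ℚ , []) ∷ []

  letter : A → Pol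
  letter a = (1ℚ , a ∷ []) ∷ []

  _⊕_ : Pol → Pol → Pol
  p ⊕ q = p ++ q

  scale : ℚ → Pol → Pol
  scale c = map (λ { (d , w) → (c * d , w) })

  ⊖_ : Pol → Pol
  ⊖ p = scale (- 1ℚ) p

  _⊝_ : Pol → Pol → Pol
  p ⊝ q = p ⊕ (⊖ q)

  _⊛_ : Pol → Pol → Pol
  p ⊛ q = concatMap (λ { (c , u) → map (λ { (d , v) → (c * d , u ++ v) }) q }) p

  [_,_] : Pol → Pol → Pol
  [ p , q ] = (p ⊛ q) ⊝ (q ⊛ p)

  _⊕₂_ : Pol2 → Pol2 → Pol2
  p ⊕₂ q = p ++ q

  _⊗_ : Pol → Pol → Pol2
  p ⊗ q = concatMap (λ { (c , u) → map (λ { (d , v) → (c * d , u , v) }) q }) p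

  -- f ⊗ id and id ⊗ f for a linear map f given on words (extended linearly)
  linExt : (Word → Pol) → Pol → Pol
  linExt f p = concatMap (λ { (c , w) → scale c (f w) }) p

  _⊗id : (Word → Pol) → Pol2 → Pol2
  (f ⊗id) p = concatMap (λ { (c , u , v) → (scale c (f u)) ⊗ ((1ℚ , v) ∷ []) }) p

  id⊗_ : (Word → Pol) → Pol2 → Pol2
  (id⊗ f) p = concatMap (λ { (c , u , v) → ((c , u) ∷ []) ⊗ (f v) }) p

  -- coproduct: the algebra morphism with every letter primitive,
  -- Δ(a₁⋯aₙ) = (a₁⊗1 + 1⊗a₁)⋯(aₙ⊗1 + 1⊗aₙ)
  Δword : Word → Pol2
  Δword [] = (1ℚ , [] , []) ∷ []
  Δword (a ∷ w) =
    concatMap (λ { (c , u , v) → (c , a ∷ u , v) ∷ (c , u , a ∷ v) ∷ [] }) (Δword w)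

  Δ : Pol → Pol2
  Δ p = concatMap (λ { (c , w) → map (λ { (d , u , v) → (c * d , u , v) }) (Δword w) }) p

  Primitive : Pol → Set
  Primitive p = Δ p ≈₂ ((p ⊗ oneP) ⊕₂ (oneP ⊗ p))

data X : Set where
  x₀ x₁ : X

_≟X_ : DecidableEquality X
x₀ ≟X x₀ = yes refl
x₀ ≟X x₁ = no (λ ())
x₁ ≟X x₀ = no (λ ())
x₁ ≟X x₁ = yes refl

module PX = Poly _≟X_
-- The alphabet Y = {y₁, y₂, …}; the natural number k encodes y_{k+1}.
module PY = Poly ℕ._≟_

ℚ⟨X⟩ : Set
ℚ⟨X⟩ = PX.Pol

WordX : Set
WordX = PX.Word

ℚ⟨Y⟩ : Set
ℚ⟨Y⟩ = PY.Pol

WordY : Set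
WordY = PY.Word

-- 𝔩𝔦𝔢(X) = the Δ_X-primitive elements
InLie : ℚ⟨X⟩ → Set
InLie = PX.Primitive

-- embedding ℚ⟨Y⟩ ⊂ ℚ⟨X⟩, y_n ↦ x₀^{n-1} x₁  (k encodes y_{k+1})
ιword : WordY → WordX
ιword [] = []
ιword (k ∷ w) = replicate k x₀ ++ (x₁ ∷ ιword w)

ι : ℚ⟨Y⟩ → ℚ⟨X⟩
ι = map (λ { (c , w) → (c , ιword w) })

-- π_Y on words: x₀^{k₁-1}x₁⋯x₀^{k_d-1}x₁x₀^r ↦ y_{k₁}⋯y_{k_d} if r = 0, else 0
πword : ℕ → WordX → Maybe WordY
πword zero [] = just []
πword (suc _) [] = nothing
πword k (x₀ ∷ w) = πword (suc k) w
πword k (x₁ ∷ w) with πword zero w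
... | just v = just (k ∷ v)
... | nothing = nothing

πY : ℚ⟨X⟩ → ℚ⟨Y⟩
πY = concatMap (λ { (c , w) → f c (πword zero w) })
  where
  f : ℚ → Maybe WordY → ℚ⟨Y⟩
  f c (just v) = (c , v) ∷ []
  f c nothing = []

dletter : ℚ⟨X⟩ → X → ℚ⟨X⟩
dletter ψ x₀ = PX.zeroP
dletter ψ x₁ = PX.[ PX.letter x₁ , ψ ]

dword : ℚ⟨X⟩ → WordX → ℚ⟨X⟩
dword ψ [] = PX.zeroP
dword ψ (a ∷ w) = PX._⊕_ (PX._⊛_ (dletter ψ a) ((1ℚ , w) ∷ []))
                         (PX._⊛_ (PX.letter a) (dword ψ w))

d : ℚ⟨X⟩ → ℚ⟨X⟩ → ℚ⟨X⟩
d ψ = PX.linExt (dword ψ)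

ihara : ℚ⟨X⟩ → ℚ⟨X⟩ → ℚ⟨X⟩
ihara ψ₁ ψ₂ = PX._⊕_ (PX._⊝_ (d ψ₁ ψ₂) (d ψ₂ ψ₁)) PX.[ ψ₁ , ψ₂ ]

s : ℚ⟨X⟩ → ℚ⟨X⟩ → ℚ⟨X⟩
s ψ p = PX._⊕_ (PX._⊛_ ψ p) (d ψ p)

-- s^Y_ψ : the unique linear map with π_Y ∘ s_ψ = s^Y_ψ ∘ π_Y;
-- since π_Y ∘ ι = id, it is given on words by s^Y_ψ(v) = π_Y(s_ψ(ι v)).
sYword : ℚ⟨X⟩ → WordY → ℚ⟨Y⟩
sYword ψ v = πY (s ψ ((1ℚ , ιword v) ∷ []))

sY : ℚ⟨X⟩ → ℚ⟨Y⟩ → ℚ⟨Y⟩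
sY ψ = PY.linExt (sYword ψ)

InStab : ℚ⟨X⟩ → Set
InStab ψ = InLie ψ ×
  (∀ (p : ℚ⟨Y⟩) →
     PY._≈₂_ (PY._⊕₂_ ((sYword ψ PY.⊗id) (PY.Δ p)) ((PY.id⊗ sYword ψ) (PY.Δ p)))
             (PY.Δ (sY ψ p)))

InLs : ℚ⟨X⟩ → Set
InLs ψ =
  (PX.coeff ψ (x₀ ∷ []) ≡ 0ℚ) × (PX.coeff ψ (x₁ ∷ []) ≡ 0ℚ) ×
  PX.Primitive ψ × PY.Primitive (πY ψ) ×
  (∀ (m : ℕ) → PX.coeff ψ (replicate (suc (2 ℕ.* m)) x₀ ++ (x₁ ∷ [])) ≡ 0ℚ)
  -- n = 2m+2 ranges over the even n ≥ 2, and x₀^{n-1}x₁ = x₀^{2m+1}x₁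

{-# OPTIONS --safe #-}
module Submission where

-- Work dually: a formal sum p is paired with a function g on its basis by
-- ⟨ p ∣ g ⟩ = Σ c · g k over the terms (c , k) of p. Coefficients are pairings with
-- indicator functions, and coefficientwise equal sums have equal pairings, so each
-- operation can be replaced by its transpose acting on functions. In particular
-- ⟨ {ψ,φ} ∣ g ⟩ = ⟨ φ ∣ sᵀ ψ g ⟩ − ⟨ ψ ∣ sᵀ φ g ⟩, since {ψ,φ} = s_ψ(φ) − s_φ(ψ).
--
-- r is primitive iff ⟨ r ∣ _ ⟩ sends Δᵀ G to G(·,1) + G(1,·). If S and T are transposes
-- of coderivations whose values at the empty word are the pairings with s and t, then
-- g ↦ ⟨ s ∣ T g ⟩ − ⟨ t ∣ S g ⟩ has this property: in the expansions of the two terms the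
-- mixed terms agree by Fubini and cancel. For a Lie element ψ, left multiplication by ψ
-- and the derivation d_ψ, whose values 0 and [x₁,ψ] on letters are primitive, are
-- coderivations of Δ_X; this gives (ii). Membership in the stabiliser says exactly that
-- s^Y_ψ is a coderivation of Δ_Y, and π_Y intertwines s_ψ with s^Y_ψ because s_ψ preserves
-- the span of the words ending in x₀, the kernel of π_Y; this gives (iii).
--
-- For w = x₀ and w = x₀ᵏx₁ one has (s_ψ(p) | w) = (ψ|1)(p|w) + (ψ|w)(p|1), which is
-- symmetric in ψ and p and therefore cancels in s_ψ(φ) − s_φ(ψ); this gives (i) and (iv)
-- for arbitrary ψ and φ.

open import Defs

open import Data.Empty using (⊥-elim)
open import Data.List using (List; []; _∷_; _++_; length; map; concatMap; replicate)
open import Data.List.Properties using (++-assoc; ++-identityʳ)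
open import Data.Maybe as Maybe using (just; nothing; maybe′)
open import Data.Nat as ℕ using (ℕ; zero; suc; z≤n; s≤s)
open import Data.Nat.Properties using (≤-refl; ≤-trans; m≤n⇒m≤1+n)
open import Data.Product using (_×_; _,_; proj₁; proj₂; uncurry; ∃-syntax)
open import Data.Product.Properties using (≡-dec)
open import Data.Rational using (ℚ; 0ℚ; 1ℚ; _+_; _*_; -_; _-_)
open import Data.Rational.Properties
  using (+-identityˡ; +-identityʳ; +-assoc; *-identityˡ; *-identityʳ; *-zeroˡ; *-zeroʳ; *-assoc; *-distribˡ-+)
open import Data.Rational.Solver using (module +-*-Solver)
open import Function using (_∘_)
open import Relation.Binary.Definitions using (DecidableEquality)
open import Relation.Binary.PropositionalEquality
  using (_≡_; _≢_; refl; sym; trans; cong; cong₂; module ≡-Reasoning)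
open import Relation.Nullary using (yes; no)

open +-*-Solver
open ≡-Reasoning

private
  variable
    K L : Set

x≡0⇒c*x+y≡y : ∀ c {x} y → x ≡ 0ℚ → c * x + y ≡ y
x≡0⇒c*x+y≡y c y refl = solve 2 (λ c y → c :* con 0ℚ :+ y := y) refl c y

+-interchange : ∀ w x y z → (w + x) + (y + z) ≡ (w + y) + (x + z)
+-interchange = solve 4 (λ w x y z → (w :+ x) :+ (y :+ z) := (w :+ y) :+ (x :+ z)) refl

⟨_∣_⟩ : List (ℚ × K) → (K → ℚ) → ℚ
⟨ [] ∣ g ⟩          = 0ℚ
⟨ (c , k) ∷ p ∣ g ⟩ = c * g k + ⟨ p ∣ g ⟩

⟨⟩-cong : ∀ (p : List (ℚ × K)) {f g} → (∀ k → f k ≡ g k) → ⟨ p ∣ f ⟩ ≡ ⟨ p ∣ g ⟩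
⟨⟩-cong []            f≗g = refl
⟨⟩-cong ((c , k) ∷ p) f≗g = cong₂ (λ x y → c * x + y) (f≗g k) (⟨⟩-cong p f≗g)

⟨⟩-++ : ∀ (p q : List (ℚ × K)) g → ⟨ p ++ q ∣ g ⟩ ≡ ⟨ p ∣ g ⟩ + ⟨ q ∣ g ⟩
⟨⟩-++ []            q g = sym (+-identityˡ ⟨ q ∣ g ⟩)
⟨⟩-++ ((c , k) ∷ p) q g =
  trans (cong (c * g k +_) (⟨⟩-++ p q g)) (sym (+-assoc (c * g k) ⟨ p ∣ g ⟩ ⟨ q ∣ g ⟩))

⟨⟩-+ : ∀ (p : List (ℚ × K)) f g → ⟨ p ∣ (λ k → f k + g k) ⟩ ≡ ⟨ p ∣ f ⟩ + ⟨ p ∣ g ⟩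
⟨⟩-+ []            f g = refl
⟨⟩-+ ((c , k) ∷ p) f g = trans (cong₂ _+_ (*-distribˡ-+ c (f k) (g k)) (⟨⟩-+ p f g))
  (+-interchange (c * f k) (c * g k) ⟨ p ∣ f ⟩ ⟨ p ∣ g ⟩)

⟨⟩-* : ∀ (p : List (ℚ × K)) c f → ⟨ p ∣ (λ k → c * f k) ⟩ ≡ c * ⟨ p ∣ f ⟩
⟨⟩-* []            c f = sym (*-zeroʳ c)
⟨⟩-* ((d , k) ∷ p) c f = trans (cong (d * (c * f k) +_) (⟨⟩-* p c f))
  (solve 4 (λ d c x s → d :* (c :* x) :+ c :* s := c :* (d :* x :+ s)) refl d c (f k) ⟨ p ∣ f ⟩)

⟨⟩-0 : ∀ (p : List (ℚ × K)) → ⟨ p ∣ (λ _ → 0ℚ) ⟩ ≡ 0ℚ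
⟨⟩-0 p = trans (⟨⟩-* p 0ℚ (λ _ → 0ℚ)) (*-zeroˡ ⟨ p ∣ (λ _ → 0ℚ) ⟩)

⟨⟩-[-] : ∀ c (k : K) g → ⟨ (c , k) ∷ [] ∣ g ⟩ ≡ c * g k
⟨⟩-[-] c k g = +-identityʳ (c * g k)

⟨⟩-basis : ∀ (k : K) g → ⟨ (1ℚ , k) ∷ [] ∣ g ⟩ ≡ g k
⟨⟩-basis k g = trans (⟨⟩-[-] 1ℚ k g) (*-identityˡ (g k))

⟨⟩-swap : ∀ (p : List (ℚ × K)) (q : List (ℚ × L)) (F : K → L → ℚ) →
  ⟨ p ∣ (λ a → ⟨ q ∣ F a ⟩) ⟩ ≡ ⟨ q ∣ (λ b → ⟨ p ∣ (λ a → F a b) ⟩) ⟩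
⟨⟩-swap []            q F = sym (⟨⟩-0 q)
⟨⟩-swap ((c , k) ∷ p) q F = begin
  c * ⟨ q ∣ F k ⟩ + ⟨ p ∣ (λ a → ⟨ q ∣ F a ⟩) ⟩
    ≡⟨ cong₂ _+_ (⟨⟩-* q c (F k)) (sym (⟨⟩-swap p q F)) ⟨
  ⟨ q ∣ (λ b → c * F k b) ⟩ + ⟨ q ∣ (λ b → ⟨ p ∣ (λ a → F a b) ⟩) ⟩
    ≡⟨ ⟨⟩-+ q (λ b → c * F k b) (λ b → ⟨ p ∣ (λ a → F a b) ⟩) ⟨
  ⟨ q ∣ (λ b → c * F k b + ⟨ p ∣ (λ a → F a b) ⟩) ⟩ ∎

⟨⟩-map : ∀ c (h : K → L) q g →
  ⟨ map (λ { (d , l) → (c * d , h l) }) q ∣ g ⟩ ≡ c * ⟨ q ∣ (λ l → g (h l)) ⟩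
⟨⟩-map c h []            g = sym (*-zeroʳ c)
⟨⟩-map c h ((d , l) ∷ q) g = trans (cong₂ _+_ (*-assoc c d (g (h l))) (⟨⟩-map c h q g))
  (sym (*-distribˡ-+ c (d * g (h l)) ⟨ q ∣ (λ l → g (h l)) ⟩))

⟨⟩-concatMap : ∀ (F : ℚ × K → List (ℚ × L)) (h : K → ℚ) g →
  (∀ c k → ⟨ F (c , k) ∣ g ⟩ ≡ c * h k) → ∀ p → ⟨ concatMap F p ∣ g ⟩ ≡ ⟨ p ∣ h ⟩
⟨⟩-concatMap F h g F-linear []            = refl
⟨⟩-concatMap F h g F-linear ((c , k) ∷ p) =
  trans (⟨⟩-++ (F (c , k)) (concatMap F p) g) (cong₂ _+_ (F-linear c k) (⟨⟩-concatMap F h g F-linear p))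

module Separation (_≟_ : DecidableEquality K) (δ : K → K → ℚ)
                  (δ-refl : ∀ k → δ k k ≡ 1ℚ) (δ-≢ : ∀ {k l} → l ≢ k → δ k l ≡ 0ℚ) where

  without : K → List (ℚ × K) → List (ℚ × K)
  without k [] = []
  without k ((c , l) ∷ p) with l ≟ k
  ... | yes _ = without k p
  ... | no _  = (c , l) ∷ without k p

  |without|≤ : ∀ k p → length (without k p) ℕ.≤ length p
  |without|≤ k [] = z≤n
  |without|≤ k ((c , l) ∷ p) with l ≟ k
  ... | yes _ = m≤n⇒m≤1+n (|without|≤ k p)
  ... | no _  = s≤s (|without|≤ k p)

  |without-head|≤ : ∀ c k p → length (without k ((c , k) ∷ p)) ℕ.≤ length p
  |without-head|≤ c k p with k ≟ k
  ... | yes _  = |without|≤ k p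
  ... | no k≢k = ⊥-elim (k≢k refl)

  ⟨⟩-split : ∀ k p g → ⟨ p ∣ g ⟩ ≡ ⟨ p ∣ δ k ⟩ * g k + ⟨ without k p ∣ g ⟩
  ⟨⟩-split k [] g = solve 1 (λ x → con 0ℚ := con 0ℚ :* x :+ con 0ℚ) refl (g k)
  ⟨⟩-split k ((c , l) ∷ p) g with l ≟ k
  ... | yes refl rewrite δ-refl l = trans (cong (c * g l +_) (⟨⟩-split l p g))
    (solve 4 (λ c x a b → c :* x :+ (a :* x :+ b) := (c :* con 1ℚ :+ a) :* x :+ b) refl
           c (g l) ⟨ p ∣ δ l ⟩ ⟨ without l p ∣ g ⟩)
  ... | no l≢k rewrite δ-≢ l≢k = trans (cong (c * g l +_) (⟨⟩-split k p g))
    (solve 5 (λ c y a x b → c :* y :+ (a :* x :+ b) := (c :* con 0ℚ :+ a) :* x :+ (c :* y :+ b)) refl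
           c (g l) ⟨ p ∣ δ k ⟩ (g k) ⟨ without k p ∣ g ⟩)

  -- Induction on the length: dropping every term whose key is that of the head shortens r.
  ⟨⟩-vanish : ∀ n r → length r ℕ.≤ n → (∀ k → ⟨ r ∣ δ k ⟩ ≡ 0ℚ) → ∀ g → ⟨ r ∣ g ⟩ ≡ 0ℚ
  ⟨⟩-vanish n       []                  _            _   g = refl
  ⟨⟩-vanish (suc n) r@((c , k) ∷ r′) (s≤s |r′|≤n) r≈0 g = begin
    ⟨ r ∣ g ⟩                                ≡⟨ ⟨⟩-split k r g ⟩
    ⟨ r ∣ δ k ⟩ * g k + ⟨ without k r ∣ g ⟩  ≡⟨ cong₂ (λ x y → x * g k + y) (r≈0 k) (rest≈0 g) ⟩
    0ℚ * g k + 0ℚ                            ≡⟨ solve 1 (λ x → con 0ℚ :* x :+ con 0ℚ := con 0ℚ) refl (g k) ⟩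
    0ℚ                                       ∎
    where
    rest≈0 : ∀ g → ⟨ without k r ∣ g ⟩ ≡ 0ℚ
    rest≈0 = ⟨⟩-vanish n (without k r) (≤-trans (|without-head|≤ c k r′) |r′|≤n) λ l → begin
      ⟨ without k r ∣ δ l ⟩
        ≡⟨ sym (x≡0⇒c*x+y≡y (δ l k) ⟨ without k r ∣ δ l ⟩ (r≈0 k)) ⟩
      δ l k * ⟨ r ∣ δ k ⟩ + ⟨ without k r ∣ δ l ⟩
        ≡⟨ cong (_+ ⟨ without k r ∣ δ l ⟩) (solve 2 (λ x y → x :* y := y :* x) refl (δ l k) ⟨ r ∣ δ k ⟩) ⟩
      ⟨ r ∣ δ k ⟩ * δ l k + ⟨ without k r ∣ δ l ⟩
        ≡⟨ ⟨⟩-split k r (δ l) ⟨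
      ⟨ r ∣ δ l ⟩
        ≡⟨ r≈0 l ⟩
      0ℚ ∎

  ⟨⟩-separates : ∀ p q → (∀ k → ⟨ p ∣ δ k ⟩ ≡ ⟨ q ∣ δ k ⟩) → ∀ g → ⟨ p ∣ g ⟩ ≡ ⟨ q ∣ g ⟩
  ⟨⟩-separates p q p≈q g = begin
    ⟨ p ∣ g ⟩
      ≡⟨ solve 2 (λ x y → x := (x :+ (:- con 1ℚ) :* y) :+ y) refl ⟨ p ∣ g ⟩ ⟨ q ∣ g ⟩ ⟩
    (⟨ p ∣ g ⟩ + - 1ℚ * ⟨ q ∣ g ⟩) + ⟨ q ∣ g ⟩
      ≡⟨ cong (_+ ⟨ q ∣ g ⟩) (trans (sym (⟨difference⟩ g)) (⟨⟩-vanish _ difference ≤-refl difference≈0 g)) ⟩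
    0ℚ + ⟨ q ∣ g ⟩
      ≡⟨ +-identityˡ ⟨ q ∣ g ⟩ ⟩
    ⟨ q ∣ g ⟩ ∎
    where
    difference : List (ℚ × K)
    difference = p ++ map (λ { (d , l) → (- 1ℚ * d , l) }) q
    ⟨difference⟩ : ∀ f → ⟨ difference ∣ f ⟩ ≡ ⟨ p ∣ f ⟩ + - 1ℚ * ⟨ q ∣ f ⟩
    ⟨difference⟩ f = trans (⟨⟩-++ p _ f) (cong (⟨ p ∣ f ⟩ +_) (⟨⟩-map (- 1ℚ) (λ l → l) q f))
    difference≈0 : ∀ k → ⟨ difference ∣ δ k ⟩ ≡ 0ℚ
    difference≈0 k = trans (⟨difference⟩ (δ k)) (trans (cong (λ x → ⟨ p ∣ δ k ⟩ + - 1ℚ * x) (sym (p≈q k)))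
      (solve 1 (λ x → x :+ (:- con 1ℚ) :* x := con 0ℚ) refl ⟨ p ∣ δ k ⟩))

module Duality {A : Set} (_≟A_ : DecidableEquality A) where

  open Poly _≟A_

  -- δ w u is 1 if u = w and 0 otherwise. It recurses on the words instead of calling _≟W_,
  -- so that it computes on words that are only partially known.
  δ : Word → Word → ℚ
  δ []      []      = 1ℚ
  δ []      (_ ∷ _) = 0ℚ
  δ (_ ∷ _) []      = 0ℚ
  δ (a ∷ w) (b ∷ u) with b ≟A a
  ... | yes _ = δ w u
  ... | no _  = 0ℚ

  δ-refl : ∀ w → δ w w ≡ 1ℚ
  δ-refl []      = refl
  δ-refl (a ∷ w) with a ≟A a
  ... | yes _  = δ-refl w
  ... | no a≢a = ⊥-elim (a≢a refl)

  δ-≢ : ∀ {w u} → u ≢ w → δ w u ≡ 0ℚ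
  δ-≢ {[]}    {[]}    u≢w = ⊥-elim (u≢w refl)
  δ-≢ {[]}    {_ ∷ _} u≢w = refl
  δ-≢ {_ ∷ _} {[]}    u≢w = refl
  δ-≢ {a ∷ w} {b ∷ u} u≢w with b ≟A a
  ... | yes refl = δ-≢ (u≢w ∘ cong (a ∷_))
  ... | no _     = refl

  coeff≡⟨δ⟩ : ∀ p w → coeff p w ≡ ⟨ p ∣ δ w ⟩
  coeff≡⟨δ⟩ []            w = refl
  coeff≡⟨δ⟩ ((c , u) ∷ p) w with u ≟W w
  ... | yes refl = cong₂ _+_ (sym (trans (cong (c *_) (δ-refl u)) (*-identityʳ c))) (coeff≡⟨δ⟩ p u)
  ... | no u≢w   = trans (coeff≡⟨δ⟩ p w) (sym (x≡0⇒c*x+y≡y c ⟨ p ∣ δ w ⟩ (δ-≢ u≢w)))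

  δ₂ : Word × Word → Word × Word → ℚ
  δ₂ (u , v) (a , b) = δ u a * δ v b

  δ₂-refl : ∀ k → δ₂ k k ≡ 1ℚ
  δ₂-refl (u , v) = cong₂ _*_ (δ-refl u) (δ-refl v)

  δ₂-≢ : ∀ {k l} → l ≢ k → δ₂ k l ≡ 0ℚ
  δ₂-≢ {u , v} {a , b} l≢k with a ≟W u
  ... | yes refl = trans (cong (δ u a *_) (δ-≢ (l≢k ∘ cong (a ,_)))) (*-zeroʳ (δ u a))
  ... | no a≢u   = trans (cong (_* δ v b) (δ-≢ a≢u)) (*-zeroˡ (δ v b))

  coeff2≡⟨δ₂⟩ : ∀ P u v → coeff2 P u v ≡ ⟨ P ∣ δ₂ (u , v) ⟩
  coeff2≡⟨δ₂⟩ [] u v = refl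
  coeff2≡⟨δ₂⟩ ((c , a , b) ∷ P) u v with a ≟W u | b ≟W v
  ... | yes refl | yes refl =
    cong₂ _+_ (sym (trans (cong (c *_) (δ₂-refl (a , b))) (*-identityʳ c))) (coeff2≡⟨δ₂⟩ P a b)
  ... | yes refl | no b≢v   = trans (coeff2≡⟨δ₂⟩ P u v)
    (sym (x≡0⇒c*x+y≡y c ⟨ P ∣ δ₂ (u , v) ⟩ (δ₂-≢ {u , v} {a , b} (b≢v ∘ cong proj₂))))
  ... | no a≢u   | _        = trans (coeff2≡⟨δ₂⟩ P u v)
    (sym (x≡0⇒c*x+y≡y c ⟨ P ∣ δ₂ (u , v) ⟩ (δ₂-≢ {u , v} {a , b} (a≢u ∘ cong proj₁))))

  ≈₂⇒⟨⟩≡ : ∀ P Q → P ≈₂ Q → ∀ g → ⟨ P ∣ g ⟩ ≡ ⟨ Q ∣ g ⟩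
  ≈₂⇒⟨⟩≡ P Q P≈Q = Separation.⟨⟩-separates (≡-dec _≟W_ _≟W_) δ₂ δ₂-refl δ₂-≢ P Q
    (λ { (u , v) → trans (sym (coeff2≡⟨δ₂⟩ P u v)) (trans (P≈Q u v) (coeff2≡⟨δ₂⟩ Q u v)) })

  ⟨⟩-scale : ∀ c p g → ⟨ scale c p ∣ g ⟩ ≡ c * ⟨ p ∣ g ⟩
  ⟨⟩-scale c p g = ⟨⟩-map c (λ w → w) p g

  ⟨⟩-⊝ : ∀ p q g → ⟨ p ⊝ q ∣ g ⟩ ≡ ⟨ p ∣ g ⟩ - ⟨ q ∣ g ⟩
  ⟨⟩-⊝ p q g = trans (⟨⟩-++ p (⊖ q) g) (trans (cong (⟨ p ∣ g ⟩ +_) (⟨⟩-scale (- 1ℚ) q g))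
    (solve 2 (λ x y → x :+ (:- con 1ℚ) :* y := x :- y) refl ⟨ p ∣ g ⟩ ⟨ q ∣ g ⟩))

  ⟨⟩-⊛ : ∀ p q g → ⟨ p ⊛ q ∣ g ⟩ ≡ ⟨ p ∣ (λ a → ⟨ q ∣ (λ b → g (a ++ b)) ⟩) ⟩
  ⟨⟩-⊛ p q g = ⟨⟩-concatMap _ _ g (λ c u → ⟨⟩-map c (u ++_) q g) p

  ⟨⟩-⊗ : ∀ p q G → ⟨ p ⊗ q ∣ uncurry G ⟩ ≡ ⟨ p ∣ (λ a → ⟨ q ∣ G a ⟩) ⟩
  ⟨⟩-⊗ p q G = ⟨⟩-concatMap _ _ (uncurry G) (λ c u → ⟨⟩-map c (u ,_) q (uncurry G)) p

  ⟨⟩-linExt : ∀ f p g → ⟨ linExt f p ∣ g ⟩ ≡ ⟨ p ∣ (λ w → ⟨ f w ∣ g ⟩) ⟩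
  ⟨⟩-linExt f p g = ⟨⟩-concatMap _ _ g (λ c w → ⟨⟩-scale c (f w) g) p

  ⟨⟩-⊗id : ∀ f P G → ⟨ (f ⊗id) P ∣ uncurry G ⟩ ≡ ⟨ P ∣ uncurry (λ u v → ⟨ f u ∣ (λ u′ → G u′ v) ⟩) ⟩
  ⟨⟩-⊗id f P G = ⟨⟩-concatMap _ _ (uncurry G) (λ { c (u , v) → begin
    ⟨ scale c (f u) ⊗ ((1ℚ , v) ∷ []) ∣ uncurry G ⟩
      ≡⟨ ⟨⟩-⊗ (scale c (f u)) ((1ℚ , v) ∷ []) G ⟩
    ⟨ scale c (f u) ∣ (λ a → ⟨ (1ℚ , v) ∷ [] ∣ G a ⟩) ⟩
      ≡⟨ ⟨⟩-scale c (f u) (λ a → ⟨ (1ℚ , v) ∷ [] ∣ G a ⟩) ⟩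
    c * ⟨ f u ∣ (λ a → ⟨ (1ℚ , v) ∷ [] ∣ G a ⟩) ⟩
      ≡⟨ cong (c *_) (⟨⟩-cong (f u) (λ a → ⟨⟩-basis v (G a))) ⟩
    c * ⟨ f u ∣ (λ a → G a v) ⟩ ∎ }) P

  ⟨⟩-id⊗ : ∀ f P G → ⟨ (id⊗ f) P ∣ uncurry G ⟩ ≡ ⟨ P ∣ uncurry (λ u v → ⟨ f v ∣ G u ⟩) ⟩
  ⟨⟩-id⊗ f P G = ⟨⟩-concatMap _ (uncurry (λ u v → ⟨ f v ∣ G u ⟩)) (uncurry G)
    (λ { c (u , v) → trans (⟨⟩-⊗ ((c , u) ∷ []) (f v) G) (⟨⟩-[-] c u (λ a → ⟨ f v ∣ G a ⟩)) }) P

  Δᵀ : (Word → Word → ℚ) → Word → ℚ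
  Δᵀ G w = ⟨ Δword w ∣ uncurry G ⟩

  ⟨⟩-Δ : ∀ p G → ⟨ Δ p ∣ uncurry G ⟩ ≡ ⟨ p ∣ Δᵀ G ⟩
  ⟨⟩-Δ p G = ⟨⟩-concatMap _ _ (uncurry G) (λ c w → ⟨⟩-map c (λ k → k) (Δword w) (uncurry G)) p

  Δᵀ-[] : ∀ G → Δᵀ G [] ≡ G [] []
  Δᵀ-[] G = ⟨⟩-basis ([] , []) (uncurry G)

  Δᵀ-∷ : ∀ G a w → Δᵀ G (a ∷ w) ≡ Δᵀ (λ u v → G (a ∷ u) v + G u (a ∷ v)) w
  Δᵀ-∷ G a w = ⟨⟩-concatMap _ (uncurry (λ u v → G (a ∷ u) v + G u (a ∷ v))) (uncurry G)
    (λ { c (u , v) → solve 3 (λ c x y → c :* x :+ (c :* y :+ con 0ℚ) := c :* (x :+ y)) refl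
                             c (G (a ∷ u) v) (G u (a ∷ v)) })
    (Δword w)

  Δᵀ-cong : ∀ {G H} → (∀ u v → G u v ≡ H u v) → ∀ w → Δᵀ G w ≡ Δᵀ H w
  Δᵀ-cong G≗H w = ⟨⟩-cong (Δword w) (λ { (u , v) → G≗H u v })

  Δᵀ-+ : ∀ G H w → Δᵀ (λ u v → G u v + H u v) w ≡ Δᵀ G w + Δᵀ H w
  Δᵀ-+ G H w = ⟨⟩-+ (Δword w) (uncurry G) (uncurry H)

  Δᵀ-⟨⟩ : ∀ (p : List (ℚ × K)) (F : K → Word → Word → ℚ) w →
    Δᵀ (λ u v → ⟨ p ∣ (λ k → F k u v) ⟩) w ≡ ⟨ p ∣ (λ k → Δᵀ (F k) w) ⟩
  Δᵀ-⟨⟩ p F w = ⟨⟩-swap (Δword w) p (λ { (u , v) k → F k u v })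

  Δᵀ-++ : ∀ G u w → Δᵀ G (u ++ w) ≡ Δᵀ (λ u₁ v₁ → Δᵀ (λ u₂ v₂ → G (u₁ ++ u₂) (v₁ ++ v₂)) w) u
  Δᵀ-++ G []      w = sym (Δᵀ-[] (λ u₁ v₁ → Δᵀ (λ u₂ v₂ → G (u₁ ++ u₂) (v₁ ++ v₂)) w))
  Δᵀ-++ G (a ∷ u) w = begin
    Δᵀ G (a ∷ u ++ w)
      ≡⟨ Δᵀ-∷ G a (u ++ w) ⟩
    Δᵀ (λ u′ v′ → G (a ∷ u′) v′ + G u′ (a ∷ v′)) (u ++ w)
      ≡⟨ Δᵀ-++ _ u w ⟩
    Δᵀ (λ u₁ v₁ → Δᵀ (λ u₂ v₂ → G (a ∷ u₁ ++ u₂) (v₁ ++ v₂) + G (u₁ ++ u₂) (a ∷ v₁ ++ v₂)) w) u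
      ≡⟨ Δᵀ-cong (λ u₁ v₁ → Δᵀ-+ _ _ w) u ⟩
    Δᵀ (λ u₁ v₁ → Δᵀ (λ u₂ v₂ → G (a ∷ u₁ ++ u₂) (v₁ ++ v₂)) w
                + Δᵀ (λ u₂ v₂ → G (u₁ ++ u₂) (a ∷ v₁ ++ v₂)) w) u
      ≡⟨ Δᵀ-∷ _ a u ⟨
    Δᵀ (λ u₁ v₁ → Δᵀ (λ u₂ v₂ → G (u₁ ++ u₂) (v₁ ++ v₂)) w) (a ∷ u) ∎

  Primitiveᵀ : Pol → Set
  Primitiveᵀ p = ∀ G → ⟨ p ∣ Δᵀ G ⟩ ≡ ⟨ p ∣ (λ a → G a []) ⟩ + ⟨ p ∣ G [] ⟩

  ⟨⟩-primitive-rhs : ∀ p G →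
    ⟨ (p ⊗ oneP) ⊕₂ (oneP ⊗ p) ∣ uncurry G ⟩ ≡ ⟨ p ∣ (λ a → G a []) ⟩ + ⟨ p ∣ G [] ⟩
  ⟨⟩-primitive-rhs p G = trans (⟨⟩-++ (p ⊗ oneP) (oneP ⊗ p) (uncurry G)) (cong₂ _+_
    (trans (⟨⟩-⊗ p oneP G) (⟨⟩-cong p (λ a → ⟨⟩-basis [] (G a))))
    (trans (⟨⟩-⊗ oneP p G) (⟨⟩-basis [] (λ a → ⟨ p ∣ G a ⟩))))

  Primitive⇒Primitiveᵀ : ∀ p → Primitive p → Primitiveᵀ p
  Primitive⇒Primitiveᵀ p prim G = begin
    ⟨ p ∣ Δᵀ G ⟩                               ≡⟨ ⟨⟩-Δ p G ⟨
    ⟨ Δ p ∣ uncurry G ⟩                        ≡⟨ ≈₂⇒⟨⟩≡ (Δ p) ((p ⊗ oneP) ⊕₂ (oneP ⊗ p)) prim (uncurry G) ⟩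
    ⟨ (p ⊗ oneP) ⊕₂ (oneP ⊗ p) ∣ uncurry G ⟩   ≡⟨ ⟨⟩-primitive-rhs p G ⟩
    ⟨ p ∣ (λ a → G a []) ⟩ + ⟨ p ∣ G [] ⟩      ∎

  Primitiveᵀ⇒Primitive : ∀ p → Primitiveᵀ p → Primitive p
  Primitiveᵀ⇒Primitive p prim u v = begin
    coeff2 (Δ p) u v                             ≡⟨ coeff2≡⟨δ₂⟩ (Δ p) u v ⟩
    ⟨ Δ p ∣ uncurry G ⟩                          ≡⟨ ⟨⟩-Δ p G ⟩
    ⟨ p ∣ Δᵀ G ⟩                                 ≡⟨ prim G ⟩
    ⟨ p ∣ (λ a → G a []) ⟩ + ⟨ p ∣ G [] ⟩        ≡⟨ ⟨⟩-primitive-rhs p G ⟨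
    ⟨ (p ⊗ oneP) ⊕₂ (oneP ⊗ p) ∣ uncurry G ⟩     ≡⟨ coeff2≡⟨δ₂⟩ ((p ⊗ oneP) ⊕₂ (oneP ⊗ p)) u v ⟨
    coeff2 ((p ⊗ oneP) ⊕₂ (oneP ⊗ p)) u v        ∎
    where
    G : Word → Word → ℚ
    G a b = δ₂ (u , v) (a , b)

  zeroP-primitive : Primitiveᵀ zeroP
  zeroP-primitive G = sym (+-identityʳ 0ℚ)

  letter-primitive : ∀ a → Primitiveᵀ (letter a)
  letter-primitive a G = begin
    ⟨ letter a ∣ Δᵀ G ⟩                                   ≡⟨ ⟨⟩-basis (a ∷ []) (Δᵀ G) ⟩
    Δᵀ G (a ∷ [])                                         ≡⟨ Δᵀ-∷ G a [] ⟩
    Δᵀ (λ u v → G (a ∷ u) v + G u (a ∷ v)) []             ≡⟨ Δᵀ-[] (λ u v → G (a ∷ u) v + G u (a ∷ v)) ⟩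
    G (a ∷ []) [] + G [] (a ∷ [])
      ≡⟨ cong₂ _+_ (⟨⟩-basis (a ∷ []) (λ u → G u [])) (⟨⟩-basis (a ∷ []) (G [])) ⟨
    ⟨ letter a ∣ (λ u → G u []) ⟩ + ⟨ letter a ∣ G [] ⟩   ∎

  -- T is the transpose of an operator s on the algebra. IsCoderivationᵀ T says
  -- Δ ∘ s = (s ⊗ id + id ⊗ s) ∘ Δ, and leibnizᵀ T is the transpose of s ⊗ id + id ⊗ s.
  leibnizᵀ : ((Word → ℚ) → Word → ℚ) → (Word → Word → ℚ) → Word → Word → ℚ
  leibnizᵀ T G a b = T (λ a′ → G a′ b) a + T (G a) b

  IsCoderivationᵀ : ((Word → ℚ) → Word → ℚ) → Set
  IsCoderivationᵀ T = ∀ G w → T (Δᵀ G) w ≡ Δᵀ (leibnizᵀ T G) w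

  +-coderivationᵀ : ∀ S T → IsCoderivationᵀ S → IsCoderivationᵀ T → IsCoderivationᵀ (λ g w → S g w + T g w)
  +-coderivationᵀ S T S-cod T-cod G w = begin
    S (Δᵀ G) w + T (Δᵀ G) w                               ≡⟨ cong₂ _+_ (S-cod G w) (T-cod G w) ⟩
    Δᵀ (leibnizᵀ S G) w + Δᵀ (leibnizᵀ T G) w             ≡⟨ Δᵀ-+ (leibnizᵀ S G) (leibnizᵀ T G) w ⟨
    Δᵀ (λ a b → leibnizᵀ S G a b + leibnizᵀ T G a b) w
      ≡⟨ Δᵀ-cong (λ a b → +-interchange (S (λ a′ → G a′ b) a) (S (G a) b)
                                        (T (λ a′ → G a′ b) a) (T (G a) b)) w ⟩
    Δᵀ (leibnizᵀ (λ g w → S g w + T g w) G) w             ∎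

  coderivationᵀ⇒primitive : ∀ S s → IsCoderivationᵀ S → (∀ f → S f [] ≡ ⟨ s ∣ f ⟩) → Primitiveᵀ s
  coderivationᵀ⇒primitive S s S-cod S[] G = begin
    ⟨ s ∣ Δᵀ G ⟩                           ≡⟨ S[] (Δᵀ G) ⟨
    S (Δᵀ G) []                            ≡⟨ trans (S-cod G []) (Δᵀ-[] (leibnizᵀ S G)) ⟩
    S (λ a → G a []) [] + S (G []) []      ≡⟨ cong₂ _+_ (S[] (λ a → G a [])) (S[] (G [])) ⟩
    ⟨ s ∣ (λ a → G a []) ⟩ + ⟨ s ∣ G [] ⟩  ∎

  ⟨⟩-coderivationᵀ-Δᵀ : ∀ s T t → Primitiveᵀ s → IsCoderivationᵀ T → (∀ f → T f [] ≡ ⟨ t ∣ f ⟩) → ∀ G →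
    ⟨ s ∣ T (Δᵀ G) ⟩ ≡ (⟨ s ∣ T (λ a → G a []) ⟩ + ⟨ s ∣ (λ a → ⟨ t ∣ G a ⟩) ⟩)
                     + (⟨ s ∣ (λ b → ⟨ t ∣ (λ a → G a b) ⟩) ⟩ + ⟨ s ∣ T (G []) ⟩)
  ⟨⟩-coderivationᵀ-Δᵀ s T t s-prim T-cod T[] G = begin
    ⟨ s ∣ T (Δᵀ G) ⟩
      ≡⟨ trans (⟨⟩-cong s (T-cod G)) (s-prim (leibnizᵀ T G)) ⟩
    ⟨ s ∣ (λ a → leibnizᵀ T G a []) ⟩ + ⟨ s ∣ leibnizᵀ T G [] ⟩
      ≡⟨ cong₂ _+_ (⟨⟩-+ s (λ a → T (λ a′ → G a′ []) a) (λ a → T (G a) []))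
                   (⟨⟩-+ s (λ b → T (λ a′ → G a′ b) []) (T (G []))) ⟩
    (⟨ s ∣ T (λ a → G a []) ⟩ + ⟨ s ∣ (λ a → T (G a) []) ⟩)
      + (⟨ s ∣ (λ b → T (λ a → G a b) []) ⟩ + ⟨ s ∣ T (G []) ⟩)
      ≡⟨ cong₂ (λ x y → (⟨ s ∣ T (λ a → G a []) ⟩ + x) + (y + ⟨ s ∣ T (G []) ⟩))
               (⟨⟩-cong s (λ a → T[] (G a))) (⟨⟩-cong s (λ b → T[] (λ a → G a b))) ⟩
    (⟨ s ∣ T (λ a → G a []) ⟩ + ⟨ s ∣ (λ a → ⟨ t ∣ G a ⟩) ⟩)
      + (⟨ s ∣ (λ b → ⟨ t ∣ (λ a → G a b) ⟩) ⟩ + ⟨ s ∣ T (G []) ⟩) ∎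

  commutator-primitive : ∀ S T s t r → IsCoderivationᵀ S → IsCoderivationᵀ T →
    (∀ f → S f [] ≡ ⟨ s ∣ f ⟩) → (∀ f → T f [] ≡ ⟨ t ∣ f ⟩) →
    (∀ g → ⟨ r ∣ g ⟩ ≡ ⟨ s ∣ T g ⟩ - ⟨ t ∣ S g ⟩) → Primitiveᵀ r
  commutator-primitive S T s t r S-cod T-cod S[] T[] ⟨r⟩ G = begin
    ⟨ r ∣ Δᵀ G ⟩
      ≡⟨ ⟨r⟩ (Δᵀ G) ⟩
    ⟨ s ∣ T (Δᵀ G) ⟩ - ⟨ t ∣ S (Δᵀ G) ⟩
      ≡⟨ cong₂ _-_ (⟨⟩-coderivationᵀ-Δᵀ s T t (coderivationᵀ⇒primitive S s S-cod S[]) T-cod T[] G)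
                   (⟨⟩-coderivationᵀ-Δᵀ t S s (coderivationᵀ⇒primitive T t T-cod T[]) S-cod S[] G) ⟩
    ((X₁ + C₁) + (C₂ + X₂))
      - ((Y₁ + ⟨ t ∣ (λ a → ⟨ s ∣ G a ⟩) ⟩) + (⟨ t ∣ (λ b → ⟨ s ∣ (λ a → G a b) ⟩) ⟩ + Y₂))
      ≡⟨ cong₂ (λ x y → ((X₁ + C₁) + (C₂ + X₂)) - ((Y₁ + x) + (y + Y₂)))
               (⟨⟩-swap s t (λ b a → G a b)) (⟨⟩-swap s t G) ⟨
    ((X₁ + C₁) + (C₂ + X₂)) - ((Y₁ + C₂) + (C₁ + Y₂))
      ≡⟨ solve 6 (λ x₁ c₁ c₂ x₂ y₁ y₂ → ((x₁ :+ c₁) :+ (c₂ :+ x₂)) :- ((y₁ :+ c₂) :+ (c₁ :+ y₂))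
                                         := (x₁ :- y₁) :+ (x₂ :- y₂)) refl X₁ C₁ C₂ X₂ Y₁ Y₂ ⟩
    (X₁ - Y₁) + (X₂ - Y₂)
      ≡⟨ cong₂ _+_ (⟨r⟩ (λ a → G a [])) (⟨r⟩ (G [])) ⟨
    ⟨ r ∣ (λ a → G a []) ⟩ + ⟨ r ∣ G [] ⟩ ∎
    where
    X₁ = ⟨ s ∣ T (λ a → G a []) ⟩
    X₂ = ⟨ s ∣ T (G []) ⟩
    Y₁ = ⟨ t ∣ S (λ a → G a []) ⟩
    Y₂ = ⟨ t ∣ S (G []) ⟩
    C₁ = ⟨ s ∣ (λ a → ⟨ t ∣ G a ⟩) ⟩
    C₂ = ⟨ s ∣ (λ b → ⟨ t ∣ (λ a → G a b) ⟩) ⟩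

  IsCoderivation : (Word → Pol) → Set
  IsCoderivation f = ∀ p → ((f ⊗id) (Δ p) ⊕₂ (id⊗ f) (Δ p)) ≈₂ Δ (linExt f p)

  coderivation⇒coderivationᵀ : ∀ f → IsCoderivation f → IsCoderivationᵀ (λ g w → ⟨ f w ∣ g ⟩)
  coderivation⇒coderivationᵀ f f-cod G w = begin
    ⟨ f w ∣ Δᵀ G ⟩
      ≡⟨ ⟨⟩-basis w (λ v → ⟨ f v ∣ Δᵀ G ⟩) ⟨
    ⟨ [w] ∣ (λ v → ⟨ f v ∣ Δᵀ G ⟩) ⟩
      ≡⟨ trans (⟨⟩-Δ (linExt f [w]) G) (⟨⟩-linExt f [w] (Δᵀ G)) ⟨
    ⟨ Δ (linExt f [w]) ∣ uncurry G ⟩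
      ≡⟨ ≈₂⇒⟨⟩≡ ((f ⊗id) (Δ [w]) ⊕₂ (id⊗ f) (Δ [w])) (Δ (linExt f [w])) (f-cod [w]) (uncurry G) ⟨
    ⟨ (f ⊗id) (Δ [w]) ⊕₂ (id⊗ f) (Δ [w]) ∣ uncurry G ⟩
      ≡⟨ ⟨⟩-++ ((f ⊗id) (Δ [w])) ((id⊗ f) (Δ [w])) (uncurry G) ⟩
    ⟨ (f ⊗id) (Δ [w]) ∣ uncurry G ⟩ + ⟨ (id⊗ f) (Δ [w]) ∣ uncurry G ⟩
      ≡⟨ cong₂ _+_ (trans (⟨⟩-⊗id f (Δ [w]) G) (trans (⟨⟩-Δ [w] G₁) (⟨⟩-basis w (Δᵀ G₁))))
                   (trans (⟨⟩-id⊗ f (Δ [w]) G) (trans (⟨⟩-Δ [w] G₂) (⟨⟩-basis w (Δᵀ G₂)))) ⟩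
    Δᵀ G₁ w + Δᵀ G₂ w
      ≡⟨ Δᵀ-+ G₁ G₂ w ⟨
    Δᵀ (leibnizᵀ (λ g w → ⟨ f w ∣ g ⟩) G) w ∎
    where
    [w] : Pol
    [w] = (1ℚ , w) ∷ []
    G₁ G₂ : Word → Word → ℚ
    G₁ a b = ⟨ f a ∣ (λ a′ → G a′ b) ⟩
    G₂ a b = ⟨ f b ∣ G a ⟩

  ℓᵀ : Pol → (Word → ℚ) → Word → ℚ
  ℓᵀ p g w = ⟨ p ∣ (λ a → g (a ++ w)) ⟩

  ℓᵀ-[] : ∀ p g → ℓᵀ p g [] ≡ ⟨ p ∣ g ⟩
  ℓᵀ-[] p g = ⟨⟩-cong p (λ a → cong g (++-identityʳ a))

  ⟨⟩-⊛-ℓᵀ : ∀ p q g → ⟨ p ⊛ q ∣ g ⟩ ≡ ⟨ q ∣ ℓᵀ p g ⟩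
  ⟨⟩-⊛-ℓᵀ p q g = trans (⟨⟩-⊛ p q g) (⟨⟩-swap p q (λ a b → g (a ++ b)))

  ⟨⟩-[,] : ∀ p q g → ⟨ [ p , q ] ∣ g ⟩ ≡ ⟨ q ∣ ℓᵀ p g ⟩ - ⟨ p ∣ ℓᵀ q g ⟩
  ⟨⟩-[,] p q g = trans (⟨⟩-⊝ (p ⊛ q) (q ⊛ p) g) (cong₂ _-_ (⟨⟩-⊛-ℓᵀ p q g) (⟨⟩-⊛-ℓᵀ q p g))

  ℓᵀ-[letter,] : ∀ a p g u →
    ℓᵀ [ letter a , p ] g u ≡ ⟨ p ∣ (λ b → g (a ∷ b ++ u)) ⟩ - ⟨ p ∣ (λ b → g (b ++ a ∷ u)) ⟩
  ℓᵀ-[letter,] a p g u = trans (⟨⟩-[,] (letter a) p (λ b → g (b ++ u))) (cong₂ _-_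
    (⟨⟩-cong p (λ b → ⟨⟩-basis (a ∷ []) (λ c → g ((c ++ b) ++ u))))
    (trans (⟨⟩-basis (a ∷ []) (ℓᵀ p (λ b → g (b ++ u)))) (⟨⟩-cong p (λ b → cong g (++-assoc b (a ∷ []) u)))))

  ℓᵀ-coderivation : ∀ p → Primitiveᵀ p → IsCoderivationᵀ (ℓᵀ p)
  ℓᵀ-coderivation p p-prim G w = begin
    ⟨ p ∣ (λ a → Δᵀ G (a ++ w)) ⟩
      ≡⟨ ⟨⟩-cong p (λ a → Δᵀ-++ G a w) ⟩
    ⟨ p ∣ Δᵀ (λ u₁ v₁ → Δᵀ (λ u₂ v₂ → G (u₁ ++ u₂) (v₁ ++ v₂)) w) ⟩
      ≡⟨ p-prim _ ⟩
    ⟨ p ∣ (λ a → Δᵀ (λ u v → G (a ++ u) v) w) ⟩ + ⟨ p ∣ (λ b → Δᵀ (λ u v → G u (b ++ v)) w) ⟩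
      ≡⟨ cong₂ _+_ (Δᵀ-⟨⟩ p (λ a u v → G (a ++ u) v) w) (Δᵀ-⟨⟩ p (λ b u v → G u (b ++ v)) w) ⟨
    Δᵀ (λ u v → ℓᵀ p (λ a′ → G a′ v) u) w + Δᵀ (λ u v → ℓᵀ p (G u) v) w
      ≡⟨ Δᵀ-+ (λ u v → ℓᵀ p (λ a′ → G a′ v) u) (λ u v → ℓᵀ p (G u) v) w ⟨
    Δᵀ (leibnizᵀ (ℓᵀ p) G) w ∎

  ℓᵀ-++-vanishes : ∀ p h a → (∀ u → h (u ++ a ∷ []) ≡ 0ℚ) → ∀ w → ℓᵀ p h (w ++ a ∷ []) ≡ 0ℚ
  ℓᵀ-++-vanishes p h a h≡0 w =
    trans (⟨⟩-cong p (λ b → trans (cong h (sym (++-assoc b w (a ∷ [])))) (h≡0 (b ++ w)))) (⟨⟩-0 p)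

  [,]-primitive : ∀ p q → Primitiveᵀ p → Primitiveᵀ q → Primitiveᵀ [ p , q ]
  [,]-primitive p q p-prim q-prim = commutator-primitive (ℓᵀ q) (ℓᵀ p) q p [ p , q ]
    (ℓᵀ-coderivation q q-prim) (ℓᵀ-coderivation p p-prim) (ℓᵀ-[] q) (ℓᵀ-[] p) (⟨⟩-[,] p q)

  -- dᵀ D is the transpose of the derivation sending each letter a to D a.
  dᵀ : (A → Pol) → (Word → ℚ) → Word → ℚ
  dᵀ D g []      = 0ℚ
  dᵀ D g (a ∷ w) = ℓᵀ (D a) g w + dᵀ D (λ u → g (a ∷ u)) w

  dᵀ-cong : ∀ D {f g} → (∀ u → f u ≡ g u) → ∀ w → dᵀ D f w ≡ dᵀ D g w
  dᵀ-cong D f≗g []      = refl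
  dᵀ-cong D f≗g (a ∷ w) = cong₂ _+_ (⟨⟩-cong (D a) (λ b → f≗g (b ++ w))) (dᵀ-cong D (λ u → f≗g (a ∷ u)) w)

  dᵀ-+ : ∀ D f g w → dᵀ D (λ u → f u + g u) w ≡ dᵀ D f w + dᵀ D g w
  dᵀ-+ D f g []      = sym (+-identityʳ 0ℚ)
  dᵀ-+ D f g (a ∷ w) = trans
    (cong₂ _+_ (⟨⟩-+ (D a) (λ b → f (b ++ w)) (λ b → g (b ++ w)))
               (dᵀ-+ D (λ u → f (a ∷ u)) (λ u → g (a ∷ u)) w))
    (+-interchange (ℓᵀ (D a) f w) (ℓᵀ (D a) g w) (dᵀ D (λ u → f (a ∷ u)) w) (dᵀ D (λ u → g (a ∷ u)) w))

  dᵀ-0 : ∀ D w → dᵀ D (λ _ → 0ℚ) w ≡ 0ℚ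
  dᵀ-0 D []      = refl
  dᵀ-0 D (a ∷ w) = trans (cong₂ _+_ (⟨⟩-0 (D a)) (dᵀ-0 D w)) (+-identityʳ 0ℚ)

  dᵀ-coderivation : ∀ D → (∀ a → Primitiveᵀ (D a)) → IsCoderivationᵀ (dᵀ D)
  dᵀ-coderivation D D-prim G []      = sym (trans (Δᵀ-[] (leibnizᵀ (dᵀ D) G)) (+-identityʳ 0ℚ))
  dᵀ-coderivation D D-prim G (a ∷ w) = begin
    ℓᵀ (D a) (Δᵀ G) w + dᵀ D (λ u → Δᵀ G (a ∷ u)) w
      ≡⟨ cong₂ _+_ (ℓᵀ-coderivation (D a) (D-prim a) G w)
                   (trans (dᵀ-cong D (λ u → Δᵀ-∷ G a u) w) (dᵀ-coderivation D D-prim G′ w)) ⟩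
    Δᵀ (leibnizᵀ (ℓᵀ (D a)) G) w + Δᵀ (leibnizᵀ (dᵀ D) G′) w
      ≡⟨ Δᵀ-+ (leibnizᵀ (ℓᵀ (D a)) G) (leibnizᵀ (dᵀ D) G′) w ⟨
    Δᵀ (λ u v → leibnizᵀ (ℓᵀ (D a)) G u v + leibnizᵀ (dᵀ D) G′ u v) w
      ≡⟨ Δᵀ-cong rearrange w ⟩
    Δᵀ (λ u v → leibnizᵀ (dᵀ D) G (a ∷ u) v + leibnizᵀ (dᵀ D) G u (a ∷ v)) w
      ≡⟨ Δᵀ-∷ (leibnizᵀ (dᵀ D) G) a w ⟨
    Δᵀ (leibnizᵀ (dᵀ D) G) (a ∷ w) ∎
    where
    G′ : Word → Word → ℚ
    G′ u v = G (a ∷ u) v + G u (a ∷ v)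
    rearrange : ∀ u v → leibnizᵀ (ℓᵀ (D a)) G u v + leibnizᵀ (dᵀ D) G′ u v
                      ≡ leibnizᵀ (dᵀ D) G (a ∷ u) v + leibnizᵀ (dᵀ D) G u (a ∷ v)
    rearrange u v = trans
      (cong (leibnizᵀ (ℓᵀ (D a)) G u v +_)
            (cong₂ _+_ (dᵀ-+ D (λ u′ → G (a ∷ u′) v) (λ u′ → G u′ (a ∷ v)) u)
                       (dᵀ-+ D (G (a ∷ u)) (λ v′ → G u (a ∷ v′)) v)))
      (solve 6 (λ l₁ l₂ m₁ m₂ m₃ m₄ → (l₁ :+ l₂) :+ ((m₁ :+ m₂) :+ (m₃ :+ m₄))
                                      := ((l₁ :+ m₁) :+ m₃) :+ (m₂ :+ (l₂ :+ m₄)))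
             refl (ℓᵀ (D a) (λ u′ → G u′ v) u) (ℓᵀ (D a) (G u) v)
                  (dᵀ D (λ u′ → G (a ∷ u′) v) u) (dᵀ D (λ u′ → G u′ (a ∷ v)) u)
                  (dᵀ D (G (a ∷ u)) v) (dᵀ D (λ v′ → G u (a ∷ v′)) v))

  dᵀ-++-vanishes : ∀ D h a → D a ≡ [] → (∀ u → h (u ++ a ∷ []) ≡ 0ℚ) → ∀ w → dᵀ D h (w ++ a ∷ []) ≡ 0ℚ
  dᵀ-++-vanishes D h a Da≡[] h≡0 [] rewrite Da≡[] = +-identityʳ 0ℚ
  dᵀ-++-vanishes D h a Da≡[] h≡0 (b ∷ w) = trans
    (cong₂ _+_ (ℓᵀ-++-vanishes (D b) h a h≡0 w)
               (dᵀ-++-vanishes D (λ u → h (b ∷ u)) a Da≡[] (λ u → h≡0 (b ∷ u)) w))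
    (+-identityʳ 0ℚ)

open PX
open Duality _≟X_
module DY = Duality ℕ._≟_

sᵀ : ℚ⟨X⟩ → (WordX → ℚ) → WordX → ℚ
sᵀ ψ g w = ℓᵀ ψ g w + dᵀ (dletter ψ) g w

sᵀ-[] : ∀ ψ g → sᵀ ψ g [] ≡ ⟨ ψ ∣ g ⟩
sᵀ-[] ψ g = trans (+-identityʳ (ℓᵀ ψ g [])) (ℓᵀ-[] ψ g)

⟨⟩-dword : ∀ ψ w g → ⟨ dword ψ w ∣ g ⟩ ≡ dᵀ (dletter ψ) g w
⟨⟩-dword ψ []      g = refl
⟨⟩-dword ψ (a ∷ w) g = begin
  ⟨ (dletter ψ a ⊛ ((1ℚ , w) ∷ [])) ⊕ (letter a ⊛ dword ψ w) ∣ g ⟩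
    ≡⟨ ⟨⟩-++ (dletter ψ a ⊛ ((1ℚ , w) ∷ [])) (letter a ⊛ dword ψ w) g ⟩
  ⟨ dletter ψ a ⊛ ((1ℚ , w) ∷ []) ∣ g ⟩ + ⟨ letter a ⊛ dword ψ w ∣ g ⟩
    ≡⟨ cong₂ _+_ (⟨⟩-⊛ (dletter ψ a) ((1ℚ , w) ∷ []) g) (⟨⟩-⊛ (letter a) (dword ψ w) g) ⟩
  ⟨ dletter ψ a ∣ (λ b → ⟨ (1ℚ , w) ∷ [] ∣ (λ c → g (b ++ c)) ⟩) ⟩
    + ⟨ letter a ∣ (λ b → ⟨ dword ψ w ∣ (λ c → g (b ++ c)) ⟩) ⟩
    ≡⟨ cong₂ _+_ (⟨⟩-cong (dletter ψ a) (λ b → ⟨⟩-basis w (λ c → g (b ++ c))))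
                 (trans (⟨⟩-basis (a ∷ []) (λ b → ⟨ dword ψ w ∣ (λ c → g (b ++ c)) ⟩))
                        (⟨⟩-dword ψ w (λ u → g (a ∷ u)))) ⟩
  ℓᵀ (dletter ψ a) g w + dᵀ (dletter ψ) (λ u → g (a ∷ u)) w ∎

⟨⟩-d : ∀ ψ p g → ⟨ d ψ p ∣ g ⟩ ≡ ⟨ p ∣ dᵀ (dletter ψ) g ⟩
⟨⟩-d ψ p g = trans (⟨⟩-linExt (dword ψ) p g) (⟨⟩-cong p (λ w → ⟨⟩-dword ψ w g))

⟨⟩-s : ∀ ψ p g → ⟨ s ψ p ∣ g ⟩ ≡ ⟨ p ∣ sᵀ ψ g ⟩
⟨⟩-s ψ p g = begin
  ⟨ (ψ ⊛ p) ⊕ d ψ p ∣ g ⟩                      ≡⟨ ⟨⟩-++ (ψ ⊛ p) (d ψ p) g ⟩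
  ⟨ ψ ⊛ p ∣ g ⟩ + ⟨ d ψ p ∣ g ⟩                ≡⟨ cong₂ _+_ (⟨⟩-⊛-ℓᵀ ψ p g) (⟨⟩-d ψ p g) ⟩
  ⟨ p ∣ ℓᵀ ψ g ⟩ + ⟨ p ∣ dᵀ (dletter ψ) g ⟩    ≡⟨ ⟨⟩-+ p (ℓᵀ ψ g) (dᵀ (dletter ψ) g) ⟨
  ⟨ p ∣ sᵀ ψ g ⟩                               ∎

⟨⟩-ihara : ∀ ψ φ g → ⟨ ihara ψ φ ∣ g ⟩ ≡ ⟨ φ ∣ sᵀ ψ g ⟩ - ⟨ ψ ∣ sᵀ φ g ⟩
⟨⟩-ihara ψ φ g = begin
  ⟨ (d ψ φ ⊝ d φ ψ) ⊕ [ ψ , φ ] ∣ g ⟩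
    ≡⟨ ⟨⟩-++ (d ψ φ ⊝ d φ ψ) [ ψ , φ ] g ⟩
  ⟨ d ψ φ ⊝ d φ ψ ∣ g ⟩ + ⟨ [ ψ , φ ] ∣ g ⟩
    ≡⟨ cong₂ _+_ (trans (⟨⟩-⊝ (d ψ φ) (d φ ψ) g) (cong₂ _-_ (⟨⟩-d ψ φ g) (⟨⟩-d φ ψ g))) (⟨⟩-[,] ψ φ g) ⟩
  (dψφ - dφψ) + (ℓψφ - ℓφψ)
    ≡⟨ solve 4 (λ d₁ d₂ ℓ₁ ℓ₂ → (d₁ :- d₂) :+ (ℓ₁ :- ℓ₂) := (ℓ₁ :+ d₁) :- (ℓ₂ :+ d₂)) refl dψφ dφψ ℓψφ ℓφψ ⟩
  (ℓψφ + dψφ) - (ℓφψ + dφψ)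
    ≡⟨ cong₂ _-_ (⟨⟩-+ φ (ℓᵀ ψ g) (dᵀ (dletter ψ) g)) (⟨⟩-+ ψ (ℓᵀ φ g) (dᵀ (dletter φ) g)) ⟨
  ⟨ φ ∣ sᵀ ψ g ⟩ - ⟨ ψ ∣ sᵀ φ g ⟩ ∎
  where
  dψφ = ⟨ φ ∣ dᵀ (dletter ψ) g ⟩
  dφψ = ⟨ ψ ∣ dᵀ (dletter φ) g ⟩
  ℓψφ = ⟨ φ ∣ ℓᵀ ψ g ⟩
  ℓφψ = ⟨ ψ ∣ ℓᵀ φ g ⟩

dletter-primitive : ∀ ψ → Primitiveᵀ ψ → ∀ a → Primitiveᵀ (dletter ψ a)
dletter-primitive ψ ψ-prim x₀ = zeroP-primitive
dletter-primitive ψ ψ-prim x₁ = [,]-primitive (letter x₁) ψ (letter-primitive x₁) ψ-prim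

sᵀ-coderivation : ∀ ψ → Primitiveᵀ ψ → IsCoderivationᵀ (sᵀ ψ)
sᵀ-coderivation ψ ψ-prim = +-coderivationᵀ (ℓᵀ ψ) (dᵀ (dletter ψ))
  (ℓᵀ-coderivation ψ ψ-prim) (dᵀ-coderivation (dletter ψ) (dletter-primitive ψ ψ-prim))

ihara-primitive : ∀ ψ φ → Primitive ψ → Primitive φ → Primitive (ihara ψ φ)
ihara-primitive ψ φ ψ-prim φ-prim = Primitiveᵀ⇒Primitive (ihara ψ φ)
  (commutator-primitive (sᵀ φ) (sᵀ ψ) φ ψ (ihara ψ φ)
    (sᵀ-coderivation φ (Primitive⇒Primitiveᵀ φ φ-prim)) (sᵀ-coderivation ψ (Primitive⇒Primitiveᵀ ψ ψ-prim))
    (sᵀ-[] φ) (sᵀ-[] ψ) (⟨⟩-ihara ψ φ))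

sᵀ-0 : ∀ ψ u → sᵀ ψ (λ _ → 0ℚ) u ≡ 0ℚ
sᵀ-0 ψ u = trans (cong₂ _+_ (⟨⟩-0 ψ) (dᵀ-0 (dletter ψ) u)) (+-identityʳ 0ℚ)

-- Transposes of s_ψ(x₁u) = x₁ s_ψ(u) and s_ψ(x₀u) = x₀ s_ψ(u) + [ψ, x₀] u.
sᵀ-x₁∷ : ∀ ψ g u → sᵀ ψ g (x₁ ∷ u) ≡ sᵀ ψ (λ v → g (x₁ ∷ v)) u
sᵀ-x₁∷ ψ g u =
  trans (cong (λ x → ℓᵀ ψ g (x₁ ∷ u) + (x + dᵀ (dletter ψ) (λ v → g (x₁ ∷ v)) u)) (ℓᵀ-[letter,] x₁ ψ g u))
        (solve 3 (λ p q r → p :+ ((q :- p) :+ r) := q :+ r) refl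
               (ℓᵀ ψ g (x₁ ∷ u)) (ℓᵀ ψ (λ v → g (x₁ ∷ v)) u) (dᵀ (dletter ψ) (λ v → g (x₁ ∷ v)) u))

sᵀ-x₀∷ : ∀ ψ g u →
  sᵀ ψ g (x₀ ∷ u) ≡ sᵀ ψ (λ v → g (x₀ ∷ v)) u + (ℓᵀ ψ g (x₀ ∷ u) - ℓᵀ ψ (λ v → g (x₀ ∷ v)) u)
sᵀ-x₀∷ ψ g u = solve 3 (λ p q r → p :+ (con 0ℚ :+ r) := (q :+ r) :+ (p :- q)) refl
  (ℓᵀ ψ g (x₀ ∷ u)) (ℓᵀ ψ (λ v → g (x₀ ∷ v)) u) (dᵀ (dletter ψ) (λ v → g (x₀ ∷ v)) u)

-- sᵀ ψ (δ w) u is the coefficient (s_ψ(u) | w).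
SplitsTrivially : WordX → Set
SplitsTrivially w = ∀ ψ u → sᵀ ψ (δ w) u ≡ coeff ψ [] * δ w u + coeff ψ w * δ [] u

coeff-ihara≡0 : ∀ w → SplitsTrivially w → ∀ ψ φ → coeff (ihara ψ φ) w ≡ 0ℚ
coeff-ihara≡0 w splits ψ φ = begin
  coeff (ihara ψ φ) w                      ≡⟨ coeff≡⟨δ⟩ (ihara ψ φ) w ⟩
  ⟨ ihara ψ φ ∣ δ w ⟩                      ≡⟨ ⟨⟩-ihara ψ φ (δ w) ⟩
  ⟨ φ ∣ sᵀ ψ (δ w) ⟩ - ⟨ ψ ∣ sᵀ φ (δ w) ⟩  ≡⟨ cong₂ _-_ (pairing φ ψ) (pairing ψ φ) ⟩
  (coeff ψ [] * coeff φ w + coeff ψ w * coeff φ []) - (coeff φ [] * coeff ψ w + coeff φ w * coeff ψ [])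
    ≡⟨ solve 4 (λ a b a′ b′ → (a :* b′ :+ b :* a′) :- (a′ :* b :+ b′ :* a) := con 0ℚ) refl
               (coeff ψ []) (coeff ψ w) (coeff φ []) (coeff φ w) ⟩
  0ℚ ∎
  where
  pairing : ∀ β α → ⟨ β ∣ sᵀ α (δ w) ⟩ ≡ coeff α [] * coeff β w + coeff α w * coeff β []
  pairing β α = begin
    ⟨ β ∣ sᵀ α (δ w) ⟩
      ≡⟨ trans (⟨⟩-cong β (splits α)) (⟨⟩-+ β (λ u → coeff α [] * δ w u) (λ u → coeff α w * δ [] u)) ⟩
    ⟨ β ∣ (λ u → coeff α [] * δ w u) ⟩ + ⟨ β ∣ (λ u → coeff α w * δ [] u) ⟩
      ≡⟨ cong₂ _+_ (⟨⟩-* β (coeff α []) (δ w)) (⟨⟩-* β (coeff α w) (δ [])) ⟩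
    coeff α [] * ⟨ β ∣ δ w ⟩ + coeff α w * ⟨ β ∣ δ [] ⟩
      ≡⟨ cong₂ (λ x y → coeff α [] * x + coeff α w * y) (coeff≡⟨δ⟩ β w) (coeff≡⟨δ⟩ β []) ⟨
    coeff α [] * coeff β w + coeff α w * coeff β [] ∎

δ[]-++-∷ : ∀ a y v → δ [] (a ++ y ∷ v) ≡ 0ℚ
δ[]-++-∷ []      y v = refl
δ[]-++-∷ (_ ∷ _) y v = refl

sᵀ-δ[] : ∀ ψ u → sᵀ ψ (δ []) u ≡ coeff ψ [] * δ [] u
sᵀ-δ[] ψ []       = trans (sᵀ-[] ψ (δ [])) (trans (sym (coeff≡⟨δ⟩ ψ [])) (sym (*-identityʳ (coeff ψ []))))
sᵀ-δ[] ψ (x₁ ∷ u) = trans (sᵀ-x₁∷ ψ (δ []) u) (trans (sᵀ-0 ψ u) (sym (*-zeroʳ (coeff ψ []))))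
sᵀ-δ[] ψ (x₀ ∷ u) = begin
  sᵀ ψ (δ []) (x₀ ∷ u)
    ≡⟨ sᵀ-x₀∷ ψ (δ []) u ⟩
  sᵀ ψ (λ _ → 0ℚ) u + (ℓᵀ ψ (δ []) (x₀ ∷ u) - ⟨ ψ ∣ (λ _ → 0ℚ) ⟩)
    ≡⟨ cong₂ (λ x y → x + (y - ⟨ ψ ∣ (λ _ → 0ℚ) ⟩)) (sᵀ-0 ψ u) (⟨⟩-cong ψ (λ a → δ[]-++-∷ a x₀ u)) ⟩
  0ℚ + (⟨ ψ ∣ (λ _ → 0ℚ) ⟩ - ⟨ ψ ∣ (λ _ → 0ℚ) ⟩)
    ≡⟨ solve 2 (λ x c → con 0ℚ :+ (x :- x) := c :* con 0ℚ) refl ⟨ ψ ∣ (λ _ → 0ℚ) ⟩ (coeff ψ []) ⟩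
  coeff ψ [] * 0ℚ ∎

splits-at-[] : ∀ ψ w → δ w [] ≡ 0ℚ → sᵀ ψ (δ w) [] ≡ coeff ψ [] * δ w [] + coeff ψ w * δ [] []
splits-at-[] ψ w δw[]≡0 = begin
  sᵀ ψ (δ w) []
    ≡⟨ trans (sᵀ-[] ψ (δ w)) (sym (coeff≡⟨δ⟩ ψ w)) ⟩
  coeff ψ w
    ≡⟨ solve 2 (λ c c′ → c′ := c :* con 0ℚ :+ c′ :* con 1ℚ) refl (coeff ψ []) (coeff ψ w) ⟩
  coeff ψ [] * 0ℚ + coeff ψ w * 1ℚ
    ≡⟨ cong (λ x → coeff ψ [] * x + coeff ψ w * 1ℚ) δw[]≡0 ⟨
  coeff ψ [] * δ w [] + coeff ψ w * 1ℚ ∎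

δ[x₀]-shift : ∀ a u → δ (x₀ ∷ []) (a ++ x₀ ∷ u) ≡ δ [] (a ++ u)
δ[x₀]-shift []       u = refl
δ[x₀]-shift (x₀ ∷ a) u = δ[]-++-∷ a x₀ u
δ[x₀]-shift (x₁ ∷ a) u = refl

x₀-splits-trivially : SplitsTrivially (x₀ ∷ [])
x₀-splits-trivially ψ []       = splits-at-[] ψ (x₀ ∷ []) refl
x₀-splits-trivially ψ (x₁ ∷ u) = trans (sᵀ-x₁∷ ψ (δ (x₀ ∷ [])) u) (trans (sᵀ-0 ψ u)
  (solve 2 (λ c c′ → con 0ℚ := c :* con 0ℚ :+ c′ :* con 0ℚ) refl (coeff ψ []) (coeff ψ (x₀ ∷ []))))
x₀-splits-trivially ψ (x₀ ∷ u) = begin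
  sᵀ ψ (δ (x₀ ∷ [])) (x₀ ∷ u)
    ≡⟨ sᵀ-x₀∷ ψ (δ (x₀ ∷ [])) u ⟩
  sᵀ ψ (δ []) u + (ℓᵀ ψ (δ (x₀ ∷ [])) (x₀ ∷ u) - ℓᵀ ψ (δ []) u)
    ≡⟨ cong₂ (λ x y → x + (y - ℓᵀ ψ (δ []) u)) (sᵀ-δ[] ψ u) (⟨⟩-cong ψ (λ a → δ[x₀]-shift a u)) ⟩
  coeff ψ [] * δ [] u + (ℓᵀ ψ (δ []) u - ℓᵀ ψ (δ []) u)
    ≡⟨ solve 4 (λ c x c′ y → c :* x :+ (y :- y) := c :* x :+ c′ :* con 0ℚ) refl
               (coeff ψ []) (δ [] u) (coeff ψ (x₀ ∷ [])) (ℓᵀ ψ (δ []) u) ⟩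
  coeff ψ [] * δ [] u + coeff ψ (x₀ ∷ []) * 0ℚ ∎

x₀ᵏx₁ : ℕ → WordX
x₀ᵏx₁ k = replicate k x₀ ++ x₁ ∷ []

δ-x₀ᵏx₁-[] : ∀ k → δ (x₀ᵏx₁ k) [] ≡ 0ℚ
δ-x₀ᵏx₁-[] zero    = refl
δ-x₀ᵏx₁-[] (suc k) = refl

δ[x₁]-++x₀ : ∀ a u → δ (x₁ ∷ []) (a ++ x₀ ∷ u) ≡ 0ℚ
δ[x₁]-++x₀ []       u = refl
δ[x₁]-++x₀ (x₀ ∷ a) u = refl
δ[x₁]-++x₀ (x₁ ∷ a) u = δ[]-++-∷ a x₀ u

δ-x₀ᵏx₁-++x₀ : ∀ k a → δ (x₀ᵏx₁ k) (a ++ x₀ ∷ []) ≡ 0ℚ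
δ-x₀ᵏx₁-++x₀ zero    a        = δ[x₁]-++x₀ a []
δ-x₀ᵏx₁-++x₀ (suc k) []       = δ-x₀ᵏx₁-[] k
δ-x₀ᵏx₁-++x₀ (suc k) (x₀ ∷ a) = δ-x₀ᵏx₁-++x₀ k a
δ-x₀ᵏx₁-++x₀ (suc k) (x₁ ∷ a) = refl

δ-x₀ᵏx₁-shift : ∀ k a y v → δ (x₀ ∷ x₀ᵏx₁ k) (a ++ x₀ ∷ y ∷ v) ≡ δ (x₀ᵏx₁ k) (a ++ y ∷ v)
δ-x₀ᵏx₁-shift k       []       y v = refl
δ-x₀ᵏx₁-shift zero    (x₀ ∷ a) y v = δ[x₁]-++x₀ a (y ∷ v)
δ-x₀ᵏx₁-shift (suc k) (x₀ ∷ a) y v = δ-x₀ᵏx₁-shift k a y v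
δ-x₀ᵏx₁-shift zero    (x₁ ∷ a) y v = sym (δ[]-++-∷ a y v)
δ-x₀ᵏx₁-shift (suc k) (x₁ ∷ a) y v = refl

x₁-splits-trivially : SplitsTrivially (x₁ ∷ [])
x₁-splits-trivially ψ []       = splits-at-[] ψ (x₁ ∷ []) refl
x₁-splits-trivially ψ (x₁ ∷ u) = trans (sᵀ-x₁∷ ψ (δ (x₁ ∷ [])) u) (trans (sᵀ-δ[] ψ u)
  (solve 3 (λ c x c′ → c :* x := c :* x :+ c′ :* con 0ℚ) refl (coeff ψ []) (δ [] u) (coeff ψ (x₁ ∷ []))))
x₁-splits-trivially ψ (x₀ ∷ u) = begin
  sᵀ ψ (δ (x₁ ∷ [])) (x₀ ∷ u)
    ≡⟨ sᵀ-x₀∷ ψ (δ (x₁ ∷ [])) u ⟩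
  sᵀ ψ (λ _ → 0ℚ) u + (ℓᵀ ψ (δ (x₁ ∷ [])) (x₀ ∷ u) - ⟨ ψ ∣ (λ _ → 0ℚ) ⟩)
    ≡⟨ cong₂ (λ x y → x + (y - ⟨ ψ ∣ (λ _ → 0ℚ) ⟩)) (sᵀ-0 ψ u) (⟨⟩-cong ψ (λ a → δ[x₁]-++x₀ a u)) ⟩
  0ℚ + (⟨ ψ ∣ (λ _ → 0ℚ) ⟩ - ⟨ ψ ∣ (λ _ → 0ℚ) ⟩)
    ≡⟨ solve 3 (λ x c c′ → con 0ℚ :+ (x :- x) := c :* con 0ℚ :+ c′ :* con 0ℚ) refl
               ⟨ ψ ∣ (λ _ → 0ℚ) ⟩ (coeff ψ []) (coeff ψ (x₁ ∷ [])) ⟩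
  coeff ψ [] * 0ℚ + coeff ψ (x₁ ∷ []) * 0ℚ ∎

x₀∷-splits-trivially : ∀ k → SplitsTrivially (x₀ᵏx₁ k) → SplitsTrivially (x₀ᵏx₁ (suc k))
x₀∷-splits-trivially k splits ψ [] = splits-at-[] ψ (x₀ᵏx₁ (suc k)) refl
x₀∷-splits-trivially k splits ψ (x₁ ∷ u) = trans (sᵀ-x₁∷ ψ (δ (x₀ᵏx₁ (suc k))) u) (trans (sᵀ-0 ψ u)
  (solve 2 (λ c c′ → con 0ℚ := c :* con 0ℚ :+ c′ :* con 0ℚ) refl (coeff ψ []) (coeff ψ (x₀ᵏx₁ (suc k)))))
x₀∷-splits-trivially k splits ψ (x₀ ∷ []) = begin
  sᵀ ψ (δ (x₀ ∷ w)) (x₀ ∷ [])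
    ≡⟨ sᵀ-x₀∷ ψ (δ (x₀ ∷ w)) [] ⟩
  sᵀ ψ (δ w) [] + (ℓᵀ ψ (δ (x₀ ∷ w)) (x₀ ∷ []) - ℓᵀ ψ (δ w) [])
    ≡⟨ cong₂ (λ x y → x + (y - ℓᵀ ψ (δ w) [])) (sᵀ-[] ψ (δ w))
             (trans (⟨⟩-cong ψ (δ-x₀ᵏx₁-++x₀ (suc k))) (⟨⟩-0 ψ)) ⟩
  ⟨ ψ ∣ δ w ⟩ + (0ℚ - ℓᵀ ψ (δ w) [])
    ≡⟨ cong (λ x → ⟨ ψ ∣ δ w ⟩ + (0ℚ - x)) (ℓᵀ-[] ψ (δ w)) ⟩
  ⟨ ψ ∣ δ w ⟩ + (0ℚ - ⟨ ψ ∣ δ w ⟩)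
    ≡⟨ solve 3 (λ x c c′ → x :+ (con 0ℚ :- x) := c :* con 0ℚ :+ c′ :* con 0ℚ) refl
               ⟨ ψ ∣ δ w ⟩ (coeff ψ []) (coeff ψ (x₀ ∷ w)) ⟩
  coeff ψ [] * 0ℚ + coeff ψ (x₀ ∷ w) * 0ℚ
    ≡⟨ cong (λ x → coeff ψ [] * x + coeff ψ (x₀ ∷ w) * 0ℚ) (δ-x₀ᵏx₁-[] k) ⟨
  coeff ψ [] * δ w [] + coeff ψ (x₀ ∷ w) * 0ℚ ∎
  where w = x₀ᵏx₁ k
x₀∷-splits-trivially k splits ψ (x₀ ∷ y ∷ v) = begin
  sᵀ ψ (δ (x₀ ∷ w)) (x₀ ∷ y ∷ v)
    ≡⟨ sᵀ-x₀∷ ψ (δ (x₀ ∷ w)) (y ∷ v) ⟩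
  sᵀ ψ (δ w) (y ∷ v) + (ℓᵀ ψ (δ (x₀ ∷ w)) (x₀ ∷ y ∷ v) - ℓᵀ ψ (δ w) (y ∷ v))
    ≡⟨ cong₂ (λ x z → x + (z - ℓᵀ ψ (δ w) (y ∷ v)))
             (splits ψ (y ∷ v)) (⟨⟩-cong ψ (λ a → δ-x₀ᵏx₁-shift k a y v)) ⟩
  (coeff ψ [] * δ w (y ∷ v) + coeff ψ w * 0ℚ) + (ℓᵀ ψ (δ w) (y ∷ v) - ℓᵀ ψ (δ w) (y ∷ v))
    ≡⟨ solve 5 (λ c x c′ c″ z → (c :* x :+ c′ :* con 0ℚ) :+ (z :- z) := c :* x :+ c″ :* con 0ℚ) refl
               (coeff ψ []) (δ w (y ∷ v)) (coeff ψ w) (coeff ψ (x₀ ∷ w)) (ℓᵀ ψ (δ w) (y ∷ v)) ⟩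
  coeff ψ [] * δ w (y ∷ v) + coeff ψ (x₀ ∷ w) * 0ℚ ∎
  where w = x₀ᵏx₁ k

x₀ᵏx₁-splits-trivially : ∀ k → SplitsTrivially (x₀ᵏx₁ k)
x₀ᵏx₁-splits-trivially zero    = x₁-splits-trivially
x₀ᵏx₁-splits-trivially (suc k) = x₀∷-splits-trivially k (x₀ᵏx₁-splits-trivially k)

sᵀ-++x₀-vanishes : ∀ ψ h → (∀ u → h (u ++ x₀ ∷ []) ≡ 0ℚ) → ∀ w → sᵀ ψ h (w ++ x₀ ∷ []) ≡ 0ℚ
sᵀ-++x₀-vanishes ψ h h≡0 w =
  trans (cong₂ _+_ (ℓᵀ-++-vanishes ψ h x₀ h≡0 w) (dᵀ-++-vanishes (dletter ψ) h x₀ refl h≡0 w))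
        (+-identityʳ 0ℚ)

πᵀ : (WordY → ℚ) → WordX → ℚ
πᵀ g w = maybe′ g 0ℚ (πword zero w)

⟨⟩-πY : ∀ p g → ⟨ πY p ∣ g ⟩ ≡ ⟨ p ∣ πᵀ g ⟩
⟨⟩-πY []            g = refl
⟨⟩-πY ((c , w) ∷ p) g with πword zero w
... | just v  = cong (c * g v +_) (⟨⟩-πY p g)
... | nothing = trans (⟨⟩-πY p g) (sym (x≡0⇒c*x+y≡y c ⟨ p ∣ πᵀ g ⟩ refl))

x₀ᵏ-++-x₀∷ : ∀ k w → replicate k x₀ ++ x₀ ∷ w ≡ replicate (suc k) x₀ ++ w
x₀ᵏ-++-x₀∷ zero    w = refl
x₀ᵏ-++-x₀∷ (suc k) w = cong (x₀ ∷_) (x₀ᵏ-++-x₀∷ k w)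

πword-x₀∷ : ∀ k w → πword k (x₀ ∷ w) ≡ πword (suc k) w
πword-x₀∷ zero    w = refl
πword-x₀∷ (suc k) w = refl

πword-x₁∷ : ∀ k w → πword k (x₁ ∷ w) ≡ Maybe.map (k ∷_) (πword zero w)
πword-x₁∷ zero    w with πword zero w
... | just _  = refl
... | nothing = refl
πword-x₁∷ (suc k) w with πword zero w
... | just _  = refl
... | nothing = refl

πword-just : ∀ k w {v} → πword k w ≡ just v → replicate k x₀ ++ w ≡ ιword v
πword-just zero    []       refl = refl
πword-just (suc k) []       ()
πword-just k       (x₀ ∷ w) eq =
  trans (x₀ᵏ-++-x₀∷ k w) (πword-just (suc k) w (trans (sym (πword-x₀∷ k w)) eq))
πword-just k       (x₁ ∷ w) eq with πword zero w in eq′ | trans (sym (πword-x₁∷ k w)) eq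
... | just _  | refl = cong (λ u → replicate k x₀ ++ x₁ ∷ u) (πword-just zero w eq′)
... | nothing | ()

πword-nothing : ∀ k w → πword k w ≡ nothing → ∃[ w′ ] replicate k x₀ ++ w ≡ w′ ++ x₀ ∷ []
πword-nothing zero    []       ()
πword-nothing (suc k) []       refl = replicate k x₀ , sym (x₀ᵏ-++-x₀∷ k [])
πword-nothing k       (x₀ ∷ w) eq with πword-nothing (suc k) w (trans (sym (πword-x₀∷ k w)) eq)
... | w′ , eq′ = w′ , trans (x₀ᵏ-++-x₀∷ k w) eq′
πword-nothing k       (x₁ ∷ w) eq with πword zero w in eq′ | trans (sym (πword-x₁∷ k w)) eq
... | just _  | ()
... | nothing | refl with πword-nothing zero w eq′
...   | w′ , eq″ = replicate k x₀ ++ x₁ ∷ w′ ,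
  trans (cong (λ u → replicate k x₀ ++ x₁ ∷ u) eq″) (sym (++-assoc (replicate k x₀) (x₁ ∷ w′) (x₀ ∷ [])))

πword-++x₀ : ∀ k u → πword k (u ++ x₀ ∷ []) ≡ nothing
πword-++x₀ zero    []       = refl
πword-++x₀ (suc k) []       = refl
πword-++x₀ k       (x₀ ∷ u) = trans (πword-x₀∷ k (u ++ x₀ ∷ [])) (πword-++x₀ (suc k) u)
πword-++x₀ k       (x₁ ∷ u) = trans (πword-x₁∷ k (u ++ x₀ ∷ [])) (cong (Maybe.map (k ∷_)) (πword-++x₀ zero u))

πᵀ-++x₀ : ∀ g u → πᵀ g (u ++ x₀ ∷ []) ≡ 0ℚ
πᵀ-++x₀ g u = cong (maybe′ g 0ℚ) (πword-++x₀ zero u)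

sYᵀ : ℚ⟨X⟩ → (WordY → ℚ) → WordY → ℚ
sYᵀ ψ g v = ⟨ sYword ψ v ∣ g ⟩

sYᵀ≡sᵀ∘πᵀ : ∀ ψ g v → sYᵀ ψ g v ≡ sᵀ ψ (πᵀ g) (ιword v)
sYᵀ≡sᵀ∘πᵀ ψ g v = begin
  ⟨ πY (s ψ ((1ℚ , ιword v) ∷ [])) ∣ g ⟩  ≡⟨ ⟨⟩-πY (s ψ ((1ℚ , ιword v) ∷ [])) g ⟩
  ⟨ s ψ ((1ℚ , ιword v) ∷ []) ∣ πᵀ g ⟩    ≡⟨ ⟨⟩-s ψ ((1ℚ , ιword v) ∷ []) (πᵀ g) ⟩
  ⟨ (1ℚ , ιword v) ∷ [] ∣ sᵀ ψ (πᵀ g) ⟩   ≡⟨ ⟨⟩-basis (ιword v) (sᵀ ψ (πᵀ g)) ⟩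
  sᵀ ψ (πᵀ g) (ιword v)                   ∎

sᵀ∘πᵀ≡πᵀ∘sYᵀ : ∀ ψ g w → sᵀ ψ (πᵀ g) w ≡ πᵀ (sYᵀ ψ g) w
sᵀ∘πᵀ≡πᵀ∘sYᵀ ψ g w with πword zero w in eq
... | just v  = trans (cong (sᵀ ψ (πᵀ g)) (πword-just zero w eq)) (sym (sYᵀ≡sᵀ∘πᵀ ψ g v))
... | nothing with πword-nothing zero w eq
...   | w′ , w≡w′x₀ = trans (cong (sᵀ ψ (πᵀ g)) w≡w′x₀) (sᵀ-++x₀-vanishes ψ (πᵀ g) (πᵀ-++x₀ g) w′)

⟨⟩-πY-ihara : ∀ ψ φ g → ⟨ πY (ihara ψ φ) ∣ g ⟩ ≡ ⟨ sYword φ [] ∣ sYᵀ ψ g ⟩ - ⟨ sYword ψ [] ∣ sYᵀ φ g ⟩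
⟨⟩-πY-ihara ψ φ g = begin
  ⟨ πY (ihara ψ φ) ∣ g ⟩
    ≡⟨ trans (⟨⟩-πY (ihara ψ φ) g) (⟨⟩-ihara ψ φ (πᵀ g)) ⟩
  ⟨ φ ∣ sᵀ ψ (πᵀ g) ⟩ - ⟨ ψ ∣ sᵀ φ (πᵀ g) ⟩
    ≡⟨ cong₂ _-_ (⟨⟩-cong φ (sᵀ∘πᵀ≡πᵀ∘sYᵀ ψ g)) (⟨⟩-cong ψ (sᵀ∘πᵀ≡πᵀ∘sYᵀ φ g)) ⟩
  ⟨ φ ∣ πᵀ (sYᵀ ψ g) ⟩ - ⟨ ψ ∣ πᵀ (sYᵀ φ g) ⟩
    ≡⟨ cong₂ _-_ (⟨sYword[]⟩ φ (sYᵀ ψ g)) (⟨sYword[]⟩ ψ (sYᵀ φ g)) ⟨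
  ⟨ sYword φ [] ∣ sYᵀ ψ g ⟩ - ⟨ sYword ψ [] ∣ sYᵀ φ g ⟩ ∎
  where
  ⟨sYword[]⟩ : ∀ α h → ⟨ sYword α [] ∣ h ⟩ ≡ ⟨ α ∣ πᵀ h ⟩
  ⟨sYword[]⟩ α h = trans (sYᵀ≡sᵀ∘πᵀ α h []) (sᵀ-[] α (πᵀ h))

πY-ihara-primitive : ∀ ψ φ → InStab ψ → InStab φ → PY.Primitive (πY (ihara ψ φ))
πY-ihara-primitive ψ φ (_ , ψ-stab) (_ , φ-stab) = DY.Primitiveᵀ⇒Primitive (πY (ihara ψ φ))
  (DY.commutator-primitive (sYᵀ φ) (sYᵀ ψ) (sYword φ []) (sYword ψ []) (πY (ihara ψ φ))
    (DY.coderivation⇒coderivationᵀ (sYword φ) φ-stab) (DY.coderivation⇒coderivationᵀ (sYword ψ) ψ-stab)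
    (λ _ → refl) (λ _ → refl) (⟨⟩-πY-ihara ψ φ))

corollary1p18 : ∀ (ψ φ : ℚ⟨X⟩) → InStab ψ → InStab φ → InLs (ihara ψ φ)
corollary1p18 ψ φ ψ-stab@(ψ-lie , _) φ-stab@(φ-lie , _) =
  coeff-ihara≡0 (x₀ ∷ []) x₀-splits-trivially ψ φ ,
  coeff-ihara≡0 (x₀ᵏx₁ 0) (x₀ᵏx₁-splits-trivially 0) ψ φ ,
  ihara-primitive ψ φ ψ-lie φ-lie ,
  πY-ihara-primitive ψ φ ψ-stab φ-stab ,
  λ m → coeff-ihara≡0 (x₀ᵏx₁ (suc (2 ℕ.* m))) (x₀ᵏx₁-splits-trivially (suc (2 ℕ.* m))) ψ φ
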